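{- Let $G=(V,E)$ be a graph, $H$ an orientation of $G$, $\Gamma$ a finite Abelian group, $\sigma:V\to\Gamma$, and $k\ge0$. Let $X\subseteq E$ and $\psi:X\to\Gamma$. Then $\psi$ is $k$-consistent if and only if the constraint $C(W)$ is satisfied by $\psi$ for every $W\subseteq V$ such that $|W|\le k$ and $W$ is the vertex set of a connected component of the graph $G-X=(V,E\setminus X)$.
   Context: Edges of $G$, their orientations in $H$, and the variables $x_e$ are identified. For $W\subseteq V$, $\partial(W)$ is the set of edges between $W$ and $V\setminus W$; $\partial_+(W)$ (resp. $\partial_-(W)$) is the set of edges of $H$ with tail (resp. head) in $W$ and the other end in $V\setminus W$. The $\Gamma$-Tseitin tautology $\mathcal C^{H,\Gamma,\sigma}$ has domain $\Gamma$, variables $x_e$ ($e\in E$), and for each $v\in V$ the constraint $\sum_{e\in\partial_+(v)}x_e-\sum_{e\in\partial_-(v)}x_e=\sigma(v)$ in $\Gamma$. For $W\subseteq V$, $\sigma(W)=\sum_{w\in W}\sigma(w)$ and $C(W)$ is the constraint $\sum_{e\in\partial_+(W)}x_e-\sum_{e\in\partial_-(W)}x_e=\sigma(W)$. A partial mapping $\psi$ from $E$ to $\Gamma$ is $k$-consistent if for all $W\subseteq V$ with $|W|\le k$ and $\partial(W)\subseteq\mathrm{dom}(\psi)$, $\psi$ satisfies $C(W)$. -}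

module Defs where

open import Level using (Level; _⊔_)
open import Data.Nat using (ℕ; zero; suc; _≤_)
open import Data.Fin using (Fin; zero; suc)
open import Data.Bool using (Bool; true; false; if_then_else_; _∧_; not)
open import Data.Vec using (lookup)
open import Data.Fin.Subset using (Subset; _∈_; _∉_; ∣_∣; Nonempty)
open import Data.Product using (Σ; _×_; _,_)
open import Data.Sum using (_⊎_)
open import Relation.Binary.PropositionalEquality using (_≡_; _≢_)
open import Algebra.Bundles using (AbelianGroup)

-- An orientation H (on vertex set Fin n, edge set Fin m) of a graph G:
-- edge e is oriented from tail e to head e.  G is obtained by forgetting
-- the orientations.
record OrientedGraph (n m : ℕ) : Set where
  field
    tail : Fin m → Fin n
    head : Fin m → Fin n

record IsSimple {n m : ℕ} (H : OrientedGraph n m) : Set where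
  open OrientedGraph H
  field
    loopless   : ∀ e → tail e ≢ head e
    noParallel : ∀ e e′ →
      ((tail e ≡ tail e′ × head e ≡ head e′) ⊎ (tail e ≡ head e′ × head e ≡ tail e′)) →
      e ≡ e′

IsFinite : ∀ {c ℓ} → AbelianGroup c ℓ → Set (c ⊔ ℓ)
IsFinite Γ = Σ ℕ λ N → Σ (Carrier → Fin N) λ f → Σ (Fin N → Carrier) λ g →
  (∀ x → g (f x) ≈ x) × (∀ i → f (g i) ≡ i)
  where open AbelianGroup Γ

module _ {c ℓ} (Γ : AbelianGroup c ℓ) where
  open AbelianGroup Γ

  sumΓ : ∀ {k} → (Fin k → Carrier) → Carrier
  sumΓ {zero}  f = ε
  sumΓ {suc k} f = f zero ∙ sumΓ (λ i → f (suc i))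

  module _ {n m : ℕ} (H : OrientedGraph n m) where
    open OrientedGraph H

    outB : Subset n → Fin m → Bool
    outB W e = lookup W (tail e) ∧ not (lookup W (head e))

    inB : Subset n → Fin m → Bool
    inB W e = lookup W (head e) ∧ not (lookup W (tail e))

    InBoundary : Subset n → Fin m → Set
    InBoundary W e = (outB W e ≡ true) ⊎ (inB W e ≡ true)

    flow : Subset n → (Fin m → Carrier) → Carrier
    flow W x = sumΓ (λ e → if outB W e then x e else (if inB W e then (x e) ⁻¹ else ε))

    charge : (Fin n → Carrier) → Subset n → Carrier
    charge σ W = sumΓ (λ v → if lookup W v then σ v else ε)

    Satisfies : (Fin n → Carrier) → Subset n → (Fin m → Carrier) → Set ℓ
    Satisfies σ W ψ = flow W ψ ≈ charge σ W

    KConsistent : (Fin n → Carrier) → ℕ → Subset m → (Fin m → Carrier) → Set ℓ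
    KConsistent σ k X ψ = ∀ (W : Subset n) → ∣ W ∣ ≤ k →
      (∀ e → InBoundary W e → e ∈ X) → Satisfies σ W ψ

module _ {n m : ℕ} (H : OrientedGraph n m) where
  open OrientedGraph H

  data Reach (X : Subset m) : Fin n → Fin n → Set where
    here  : ∀ {u} → Reach X u u
    fwd   : ∀ {v} e → e ∉ X → Reach X (head e) v → Reach X (tail e) v
    bwd   : ∀ {v} e → e ∉ X → Reach X (tail e) v → Reach X (head e) v

  IsComponent : Subset m → Subset n → Set
  IsComponent X W =
    Nonempty W ×
    (∀ e → e ∉ X → (tail e ∈ W → head e ∈ W) × (head e ∈ W → tail e ∈ W)) ×
    (∀ u v → u ∈ W → v ∈ W → Reach X u v)

module Submission where

-- Call S ⊆ V *closed* (w.r.t. X) if no edge of E ∖ X has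
-- exactly one endpoint in S; equivalently ∂(S) ⊆ X.  The vertex sets of the
-- components of G − X are closed, so k-consistency gives the constraint on
-- every small component.  Conversely, the constraints C(W) are additive:
-- if C ⊆ W then  flow(W) = flow(C) + flow(W ∖ C)  (edges between C and W ∖ C
-- are counted once with each sign) and  σ(W) = σ(C) + σ(W ∖ C).  A nonempty
-- closed W contains the component C of any of its vertices, and W ∖ C is
-- again closed and strictly smaller, so by induction on |W| every closed W
-- with |W| ≤ k satisfies C(W) once all components of size ≤ k do.

open import Defs
open import Data.Nat using (ℕ; zero; suc; _≤_; _<_)
open import Data.Nat.Properties using (≤-trans; ≤-<-trans; <⇒≤; <⇒≱; ≤-reflexive)
open import Data.Nat.Induction using (<-wellFounded)
open import Data.Fin using (Fin; zero; suc; _≟_)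
open import Data.Fin.Properties using (any?)
open import Data.Fin.Subset
  using (Subset; _∈_; _∉_; ∣_∣; _⊆_; _⊂_; _∪_; _─_; ⁅_⁆; ⊥; outside; inside)
open import Data.Fin.Subset.Properties
  using (_∈?_; nonempty?; ∣p∣≤n; p⊆q⇒∣p∣≤∣q∣; p⊂q⇒∣p∣<∣q∣; x∈⁅x⁆; x∈⁅y⁆⇒x≡y;
         ∣⁅x⁆∣≡1; Empty-unique; p⊆p∪q; q⊆p∪q; x∈p∪q⁻; x∈p∧x∉q⇒x∈p─q;
         x∈p∩q⁺; p∩q≢∅⇒∣p─q∣<∣p∣)
open import Data.Bool using (Bool; true; false; if_then_else_; _∧_; not; f≤t; b≤b)
  renaming (_≤_ to _≤ᵇ_)
open import Data.Bool.Properties using (∧-identityʳ; ∧-zeroʳ; ¬-not)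
  renaming (≤-minimum to ≤ᵇ-minimum; ≤-reflexive to ≤ᵇ-reflexive)
open import Data.Vec using (_∷_; lookup; tabulate)
open import Data.Vec.Properties using ([]=⇒lookup; lookup⇒[]=; lookup∘tabulate; lookup-replicate)
open import Data.Product using (_×_; _,_; proj₁; proj₂; ∃)
open import Data.Sum using (_⊎_; inj₁; inj₂)
open import Data.Empty using (⊥-elim)
open import Function using (_on_)
open import Induction.WellFounded using (Acc; acc)
import Relation.Binary.Construct.On as On
open import Relation.Nullary using (¬_; Dec; yes; no; does)
open import Relation.Nullary.Decidable using (_×-dec_; _⊎-dec_; ¬?; dec-true; decidable-stable)
open import Relation.Binary.PropositionalEquality as ≡ using (_≡_; refl; cong; cong₂; subst)
open import Algebra.Bundles using (AbelianGroup)

lookup-─ : ∀ {n} (p q : Subset n) v → lookup (p ─ q) v ≡ lookup p v ∧ not (lookup q v)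
lookup-─ (s ∷ p) (outside ∷ q) zero    = ≡.sym (∧-identityʳ s)
lookup-─ (s ∷ p) (inside ∷ q)  zero    = ≡.sym (∧-zeroʳ s)
lookup-─ (s ∷ p) (t ∷ q)       (suc v) = lookup-─ p q v

∧-not-true : ∀ {a b} → a ∧ not b ≡ true → a ≡ true × b ≡ false
∧-not-true {true}  {false} _ = refl , refl
∧-not-true {true}  {true}  ()
∧-not-true {false}         ()

lookup-false⇒∉ : ∀ {n} {p : Subset n} {v} → lookup p v ≡ false → v ∉ p
lookup-false⇒∉ p[v]≡false v∈p with ≡.trans (≡.sym p[v]≡false) ([]=⇒lookup v∈p)
... | ()

∉⇒lookup-false : ∀ {n} {p : Subset n} {v} → v ∉ p → lookup p v ≡ false
∉⇒lookup-false {p = p} {v} v∉p = ¬-not (λ v∈p → v∉p (lookup⇒[]= v p v∈p))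

∈─⁻ : ∀ {n} {p q : Subset n} {v} → v ∈ p ─ q → v ∈ p × v ∉ q
∈─⁻ {p = p} {q} {v} v∈p─q with ∧-not-true (≡.trans (≡.sym (lookup-─ p q v)) ([]=⇒lookup v∈p─q))
... | v∈p , v∉q = lookup⇒[]= v p v∈p , lookup-false⇒∉ v∉q

lookup-⊆ : ∀ {n} {p q : Subset n} → p ⊆ q → ∀ v → lookup p v ≤ᵇ lookup q v
lookup-⊆ {p = p} p⊆q v with lookup p v in p[v]
... | false = ≤ᵇ-minimum _
... | true  = ≤ᵇ-reflexive (≡.sym ([]=⇒lookup (p⊆q (lookup⇒[]= v p p[v]))))

module _ {c ℓ} (Γ : AbelianGroup c ℓ) where
  open AbelianGroup Γ
    using (Carrier; _≈_; _∙_; ε; _⁻¹; setoid; commutativeMonoid;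
           identityˡ; identityʳ; inverseˡ; inverseʳ; ∙-cong)
    renaming (refl to ≈-refl; sym to ≈-sym; trans to ≈-trans)
  open import Algebra.Properties.CommutativeMonoid.Sum commutativeMonoid
    using (sum; ∑-distrib-+; sum-cong-≋; sum-replicate-zero)
  open import Relation.Binary.Reasoning.Setoid setoid

  sumΓ≡sum : ∀ {k} (f : Fin k → Carrier) → sumΓ Γ f ≡ sum f
  sumΓ≡sum {zero}  f = refl
  sumΓ≡sum {suc k} f = cong (f zero ∙_) (sumΓ≡sum (λ i → f (suc i)))

  sumΓ-ε : ∀ {k} (f : Fin k → Carrier) → (∀ i → f i ≈ ε) → sumΓ Γ f ≈ ε
  sumΓ-ε {k} f f≈ε = begin
    sumΓ Γ f                  ≡⟨ sumΓ≡sum f ⟩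
    sum f                     ≈⟨ sum-cong-≋ {k} f≈ε ⟩
    sum {k} (λ _ → ε)         ≈⟨ sum-replicate-zero k ⟩
    ε                         ∎

  sumΓ-split : ∀ {k} (f g h : Fin k → Carrier) → (∀ i → f i ≈ g i ∙ h i) →
    sumΓ Γ f ≈ sumΓ Γ g ∙ sumΓ Γ h
  sumΓ-split f g h f≈gh = begin
    sumΓ Γ f                  ≡⟨ sumΓ≡sum f ⟩
    sum f                     ≈⟨ sum-cong-≋ f≈gh ⟩
    sum (λ i → g i ∙ h i)     ≈⟨ ∑-distrib-+ g h ⟩
    sum g ∙ sum h             ≡⟨ cong₂ _∙_ (sumΓ≡sum g) (sumΓ≡sum h) ⟨
    sumΓ Γ g ∙ sumΓ Γ h       ∎

  edgeTerm : Bool → Bool → Carrier → Carrier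
  edgeTerm a b y = if a ∧ not b then y else (if b ∧ not a then y ⁻¹ else ε)

  -- Splitting S into C ⊆ S and S ∖ C splits each edge's contribution; an edge
  -- between C and S ∖ C contributes y to one part and y⁻¹ to the other.
  edgeTerm-split : ∀ {a b c d} y → c ≤ᵇ a → d ≤ᵇ b →
    edgeTerm a b y ≈ edgeTerm c d y ∙ edgeTerm (a ∧ not c) (b ∧ not d) y
  edgeTerm-split {a = false} {b = false} y b≤b b≤b = ≈-sym (identityˡ ε)
  edgeTerm-split {a = false} {b = true}  y b≤b b≤b = ≈-sym (identityʳ (y ⁻¹))
  edgeTerm-split {a = false}             y b≤b f≤t = ≈-sym (identityˡ (y ⁻¹))
  edgeTerm-split {a = true}  {b = false} y b≤b b≤b = ≈-sym (identityʳ y)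
  edgeTerm-split {a = true}  {b = true}  y b≤b b≤b = ≈-sym (identityˡ ε)
  edgeTerm-split {a = true}              y b≤b f≤t = ≈-sym (inverseʳ y)
  edgeTerm-split             {b = false} y f≤t b≤b = ≈-sym (identityˡ y)
  edgeTerm-split             {b = true}  y f≤t b≤b = ≈-sym (inverseˡ y)
  edgeTerm-split                         y f≤t f≤t = ≈-sym (identityˡ ε)

  vertexTerm : Bool → Carrier → Carrier
  vertexTerm a s = if a then s else ε

  vertexTerm-split : ∀ {a c} s → c ≤ᵇ a →
    vertexTerm a s ≈ vertexTerm c s ∙ vertexTerm (a ∧ not c) s
  vertexTerm-split {a = false} s b≤b = ≈-sym (identityˡ ε)
  vertexTerm-split {a = true}  s b≤b = ≈-sym (identityʳ s)
  vertexTerm-split             s f≤t = ≈-sym (identityˡ s)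

  module _ {n m : ℕ} (H : OrientedGraph n m) where
    open OrientedGraph H

    flow-split : ∀ {C S : Subset n} (x : Fin m → Carrier) → C ⊆ S →
      flow Γ H S x ≈ flow Γ H C x ∙ flow Γ H (S ─ C) x
    flow-split {C} {S} x C⊆S = sumΓ-split _ _ _ λ e → term (x e) (tail e) (head e)
      where
      term : ∀ y u v → edgeTerm (lookup S u) (lookup S v) y ≈
        edgeTerm (lookup C u) (lookup C v) y ∙ edgeTerm (lookup (S ─ C) u) (lookup (S ─ C) v) y
      term y u v rewrite lookup-─ S C u | lookup-─ S C v =
        edgeTerm-split y (lookup-⊆ C⊆S u) (lookup-⊆ C⊆S v)

    charge-split : ∀ {C S : Subset n} (σ : Fin n → Carrier) → C ⊆ S →
      charge Γ H σ S ≈ charge Γ H σ C ∙ charge Γ H σ (S ─ C)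
    charge-split {C} {S} σ C⊆S = sumΓ-split _ _ _ term
      where
      term : ∀ v → vertexTerm (lookup S v) (σ v) ≈
        vertexTerm (lookup C v) (σ v) ∙ vertexTerm (lookup (S ─ C) v) (σ v)
      term v rewrite lookup-─ S C v = vertexTerm-split (σ v) (lookup-⊆ C⊆S v)

    satisfies-split : ∀ {C S : Subset n} (σ : Fin n → Carrier) (x : Fin m → Carrier) →
      C ⊆ S → Satisfies Γ H σ C x → Satisfies Γ H σ (S ─ C) x → Satisfies Γ H σ S x
    satisfies-split {C} {S} σ x C⊆S satC satS─C = begin
      flow Γ H S x                          ≈⟨ flow-split x C⊆S ⟩
      flow Γ H C x ∙ flow Γ H (S ─ C) x     ≈⟨ ∙-cong satC satS─C ⟩
      charge Γ H σ C ∙ charge Γ H σ (S ─ C) ≈⟨ charge-split σ C⊆S ⟨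
      charge Γ H σ S                        ∎

    satisfies-⊥ : (σ : Fin n → Carrier) (x : Fin m → Carrier) → Satisfies Γ H σ ⊥ x
    satisfies-⊥ σ x = ≈-trans (sumΓ-ε _ edge) (≈-sym (sumΓ-ε _ vertex))
      where
      edge : ∀ e → edgeTerm (lookup ⊥ (tail e)) (lookup ⊥ (head e)) (x e) ≈ ε
      edge e rewrite lookup-replicate {n = n} (tail e) outside
                   | lookup-replicate {n = n} (head e) outside = ≈-refl
      vertex : ∀ v → vertexTerm (lookup ⊥ v) (σ v) ≈ ε
      vertex v rewrite lookup-replicate {n = n} v outside = ≈-refl

module _ {n m : ℕ} (H : OrientedGraph n m) where
  open OrientedGraph H

  Crosses : Subset n → Fin m → Set
  Crosses S e = (tail e ∈ S × head e ∉ S) ⊎ (head e ∈ S × tail e ∉ S)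

  crosses? : ∀ S e → Dec (Crosses S e)
  crosses? S e = (tail e ∈? S ×-dec ¬? (head e ∈? S)) ⊎-dec (head e ∈? S ×-dec ¬? (tail e ∈? S))

  inBoundary⇒crosses : ∀ {c ℓ} (Γ : AbelianGroup c ℓ) {S e} → InBoundary Γ H S e → Crosses S e
  inBoundary⇒crosses Γ {S} {e} (inj₁ out) with ∧-not-true out
  ... | t∈S , h∉S = inj₁ (lookup⇒[]= (tail e) S t∈S , lookup-false⇒∉ h∉S)
  inBoundary⇒crosses Γ {S} {e} (inj₂ into) with ∧-not-true into
  ... | h∈S , t∉S = inj₂ (lookup⇒[]= (head e) S h∈S , lookup-false⇒∉ t∉S)

  crosses⇒inBoundary : ∀ {c ℓ} (Γ : AbelianGroup c ℓ) {S e} → Crosses S e → InBoundary Γ H S e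
  crosses⇒inBoundary Γ (inj₁ (t∈S , h∉S)) =
    inj₁ (cong₂ (λ a b → a ∧ not b) ([]=⇒lookup t∈S) (∉⇒lookup-false h∉S))
  crosses⇒inBoundary Γ (inj₂ (h∈S , t∉S)) =
    inj₂ (cong₂ (λ a b → a ∧ not b) ([]=⇒lookup h∈S) (∉⇒lookup-false t∉S))

  module _ (X : Subset m) where

    -- S is closed in G − X: every edge outside X with one endpoint in S has
    -- both.  This is literally the second clause of  IsComponent H X S.
    Closed : Subset n → Set
    Closed S = ∀ e → e ∉ X → (tail e ∈ S → head e ∈ S) × (head e ∈ S → tail e ∈ S)

    closed⇒¬crosses : ∀ {S e} → Closed S → e ∉ X → ¬ Crosses S e
    closed⇒¬crosses {e = e} closed e∉X (inj₁ (t∈S , h∉S)) = h∉S (proj₁ (closed e e∉X) t∈S)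
    closed⇒¬crosses {e = e} closed e∉X (inj₂ (h∈S , t∉S)) = t∉S (proj₂ (closed e e∉X) h∈S)

    ¬crosses⇒closed : ∀ {S} → (∀ e → e ∉ X → ¬ Crosses S e) → Closed S
    ¬crosses⇒closed {S} noCross e e∉X =
      (λ t∈S → decidable-stable (head e ∈? S) (λ h∉S → noCross e e∉X (inj₁ (t∈S , h∉S)))) ,
      (λ h∈S → decidable-stable (tail e ∈? S) (λ t∉S → noCross e e∉X (inj₂ (h∈S , t∉S))))

    closed-or-crossing : ∀ S → Closed S ⊎ ∃ λ e → e ∉ X × Crosses S e
    closed-or-crossing S with any? (λ e → ¬? (e ∈? X) ×-dec crosses? S e)
    ... | yes crossing = inj₂ crossing
    ... | no none      = inj₁ (¬crosses⇒closed λ e e∉X cross → none (e , e∉X , cross))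

    closed⇒boundary⊆X : ∀ {c ℓ} (Γ : AbelianGroup c ℓ) {S} → Closed S →
      ∀ e → InBoundary Γ H S e → e ∈ X
    closed⇒boundary⊆X Γ closed e e∈∂S =
      decidable-stable (e ∈? X) (λ e∉X → closed⇒¬crosses closed e∉X (inBoundary⇒crosses Γ e∈∂S))

    boundary⊆X⇒closed : ∀ {c ℓ} (Γ : AbelianGroup c ℓ) {S} →
      (∀ e → InBoundary Γ H S e → e ∈ X) → Closed S
    boundary⊆X⇒closed Γ ∂S⊆X = ¬crosses⇒closed λ e e∉X cross → e∉X (∂S⊆X e (crosses⇒inBoundary Γ cross))

    closed-─ : ∀ {S C} → Closed S → Closed C → Closed (S ─ C)
    closed-─ {S} {C} closedS closedC e e∉X = along (proj₁ (closedS e e∉X)) (proj₂ (closedC e e∉X)) ,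
                                             along (proj₂ (closedS e e∉X)) (proj₁ (closedC e e∉X))
      where
      along : ∀ {u v} → (u ∈ S → v ∈ S) → (v ∈ C → u ∈ C) → u ∈ S ─ C → v ∈ S ─ C
      along S-step C-step u∈S─C with ∈─⁻ u∈S─C
      ... | u∈S , u∉C = x∈p∧x∉q⇒x∈p─q (S-step u∈S) (λ v∈C → u∉C (C-step v∈C))

    reach-trans : ∀ {a b c} → Reach H X a b → Reach H X b c → Reach H X a c
    reach-trans here             q = q
    reach-trans (fwd e e∉X path) q = fwd e e∉X (reach-trans path q)
    reach-trans (bwd e e∉X path) q = bwd e e∉X (reach-trans path q)

    reach-sym : ∀ {a b} → Reach H X a b → Reach H X b a
    reach-sym here             = here
    reach-sym (fwd e e∉X path) = reach-trans (reach-sym path) (bwd e e∉X here)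
    reach-sym (bwd e e∉X path) = reach-trans (reach-sym path) (fwd e e∉X here)

    reach-closed : ∀ {S a b} → Closed S → a ∈ S → Reach H X a b → b ∈ S
    reach-closed closed a∈S here             = a∈S
    reach-closed closed a∈S (fwd e e∉X path) = reach-closed closed (proj₁ (closed e e∉X) a∈S) path
    reach-closed closed a∈S (bwd e e∉X path) = reach-closed closed (proj₂ (closed e e∉X) a∈S) path

    Adjacent : Subset n → Fin n → Set
    Adjacent S w = ∃ λ e → e ∉ X × ((tail e ∈ S × head e ≡ w) ⊎ (head e ∈ S × tail e ≡ w))

    adjacent? : ∀ S w → Dec (Adjacent S w)
    adjacent? S w = any? λ e → ¬? (e ∈? X) ×-dec
      ((tail e ∈? S ×-dec head e ≟ w) ⊎-dec (head e ∈? S ×-dec tail e ≟ w))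

    neighbours : Subset n → Subset n
    neighbours S = tabulate λ w → does (adjacent? S w)

    ∈neighbours⁺ : ∀ {S w} → Adjacent S w → w ∈ neighbours S
    ∈neighbours⁺ {S} {w} adj =
      lookup⇒[]= w _ (≡.trans (lookup∘tabulate _ w) (dec-true (adjacent? S w) adj))

    ∈neighbours⁻ : ∀ {S w} → w ∈ neighbours S → Adjacent S w
    ∈neighbours⁻ {S} {w} w∈N with adjacent? S w | ≡.trans (≡.sym (lookup∘tabulate _ w)) ([]=⇒lookup w∈N)
    ... | yes adj | _  = adj
    ... | no _    | ()

    extend : Subset n → Subset n
    extend S = S ∪ neighbours S

    extend-⊇ : ∀ {S} → S ⊆ extend S
    extend-⊇ {S} = p⊆p∪q (neighbours S)

    closed⇒extend⊆ : ∀ {S} → Closed S → extend S ⊆ S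
    closed⇒extend⊆ {S} closed w∈ext with x∈p∪q⁻ S (neighbours S) w∈ext
    ... | inj₁ w∈S = w∈S
    ... | inj₂ w∈N with ∈neighbours⁻ w∈N
    ...   | e , e∉X , inj₁ (t∈S , refl) = proj₁ (closed e e∉X) t∈S
    ...   | e , e∉X , inj₂ (h∈S , refl) = proj₂ (closed e e∉X) h∈S

    closed-extend : ∀ {S} → Closed S → Closed (extend S)
    closed-extend closed e e∉X =
      (λ t∈ → extend-⊇ (proj₁ (closed e e∉X) (closed⇒extend⊆ closed t∈))) ,
      (λ h∈ → extend-⊇ (proj₂ (closed e e∉X) (closed⇒extend⊆ closed h∈)))

    crossing⇒extend⊃ : ∀ {S e} → e ∉ X → Crosses S e → S ⊂ extend S
    crossing⇒extend⊃ {S} {e} e∉X (inj₁ (t∈S , h∉S)) =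
      extend-⊇ , head e , q⊆p∪q S _ (∈neighbours⁺ (e , e∉X , inj₁ (t∈S , refl))) , h∉S
    crossing⇒extend⊃ {S} {e} e∉X (inj₂ (h∈S , t∉S)) =
      extend-⊇ , tail e , q⊆p∪q S _ (∈neighbours⁺ (e , e∉X , inj₂ (h∈S , refl))) , t∉S

    ball : Fin n → ℕ → Subset n
    ball u zero    = ⁅ u ⁆
    ball u (suc i) = extend (ball u i)

    centre∈ball : ∀ u i → u ∈ ball u i
    centre∈ball u zero    = x∈⁅x⁆ u
    centre∈ball u (suc i) = extend-⊇ (centre∈ball u i)

    ball-reach : ∀ {u w} i → w ∈ ball u i → Reach H X u w
    ball-reach {u} zero w∈ with x∈⁅y⁆⇒x≡y u w∈
    ... | refl = here
    ball-reach {u} (suc i) w∈ with x∈p∪q⁻ (ball u i) _ w∈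
    ... | inj₁ w∈B = ball-reach i w∈B
    ... | inj₂ w∈N with ∈neighbours⁻ w∈N
    ...   | e , e∉X , inj₁ (t∈B , refl) = reach-trans (ball-reach i t∈B) (fwd e e∉X here)
    ...   | e , e∉X , inj₂ (h∈B , refl) = reach-trans (ball-reach i h∈B) (bwd e e∉X here)

    -- Until the balls stop growing they gain a vertex at each step.
    ball-closed-or-large : ∀ u i → Closed (ball u i) ⊎ i < ∣ ball u i ∣
    ball-closed-or-large u zero = inj₂ (≤-reflexive (≡.sym (∣⁅x⁆∣≡1 u)))
    ball-closed-or-large u (suc i) with ball-closed-or-large u i | closed-or-crossing (ball u i)
    ... | inj₁ closed | _                        = inj₁ (closed-extend closed)
    ... | inj₂ _      | inj₁ closed              = inj₁ (closed-extend closed)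
    ... | inj₂ i<∣B∣  | inj₂ (e , e∉X , cross) =
      inj₂ (≤-<-trans i<∣B∣ (p⊂q⇒∣p∣<∣q∣ (crossing⇒extend⊃ e∉X cross)))

    -- The component of u: the ball of radius n, which has stabilised.
    component : Fin n → Subset n
    component u = ball u n

    component-closed : ∀ u → Closed (component u)
    component-closed u with ball-closed-or-large u n
    ... | inj₁ closed = closed
    ... | inj₂ n<∣C∣  = ⊥-elim (<⇒≱ n<∣C∣ (∣p∣≤n (component u)))

    component-isComponent : ∀ u → IsComponent H X (component u)
    component-isComponent u =
      (u , centre∈ball u n) ,
      component-closed u ,
      λ a b a∈C b∈C → reach-trans (reach-sym (ball-reach n a∈C)) (ball-reach n b∈C)

    component-⊆ : ∀ {S u} → Closed S → u ∈ S → component u ⊆ S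
    component-⊆ closed u∈S w∈C = reach-closed closed u∈S (ball-reach n w∈C)

module _ {c ℓ} (Γ : AbelianGroup c ℓ) {n m : ℕ} (H : OrientedGraph n m) (X : Subset m)
         (σ : Fin n → AbelianGroup.Carrier Γ) (ψ : Fin m → AbelianGroup.Carrier Γ) where

  closed-satisfies : ∀ k → (∀ C → ∣ C ∣ ≤ k → IsComponent H X C → Satisfies Γ H σ C ψ) →
    ∀ S → ∣ S ∣ ≤ k → Closed H X S → Satisfies Γ H σ S ψ
  closed-satisfies k components S = go S (On.wellFounded ∣_∣ <-wellFounded S)
    where
    go : ∀ S → Acc (_<_ on ∣_∣) S → ∣ S ∣ ≤ k → Closed H X S → Satisfies Γ H σ S ψ
    go S (acc smaller) ∣S∣≤k closedS with nonempty? S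
    ... | no empty = subst (λ T → Satisfies Γ H σ T ψ) (≡.sym (Empty-unique empty)) (satisfies-⊥ Γ H σ ψ)
    ... | yes (u , u∈S) = satisfies-split Γ H σ ψ C⊆S satC satS─C
      where
      C = component H X u
      C⊆S : C ⊆ S
      C⊆S = component-⊆ H X closedS u∈S
      satC : Satisfies Γ H σ C ψ
      satC = components C (≤-trans (p⊆q⇒∣p∣≤∣q∣ C⊆S) ∣S∣≤k) (component-isComponent H X u)
      ∣S─C∣<∣S∣ : ∣ S ─ C ∣ < ∣ S ∣
      ∣S─C∣<∣S∣ = p∩q≢∅⇒∣p─q∣<∣p∣ S C (u , x∈p∩q⁺ (u∈S , centre∈ball H X u n))
      satS─C : Satisfies Γ H σ (S ─ C) ψ
      satS─C = go (S ─ C) (smaller ∣S─C∣<∣S∣) (≤-trans (<⇒≤ ∣S─C∣<∣S∣) ∣S∣≤k)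
                  (closed-─ H X closedS (component-closed H X u))

-- Components are closed, i.e. have ∂(W) ⊆ X, which gives (⇒);
-- (⇐) is closed-satisfies, since ∂(W) ⊆ X means W is closed.
mainTheorem9 : ∀ {c ℓ} {n m : ℕ} (H : OrientedGraph n m) → IsSimple H →
    (Γ : AbelianGroup c ℓ) → IsFinite Γ →
    (σ : Fin n → AbelianGroup.Carrier Γ) (k : ℕ) (X : Subset m)
    (ψ : Fin m → AbelianGroup.Carrier Γ) →
    (KConsistent Γ H σ k X ψ →
      (∀ (W : Subset n) → ∣ W ∣ ≤ k → IsComponent H X W → Satisfies Γ H σ W ψ))
    × ((∀ (W : Subset n) → ∣ W ∣ ≤ k → IsComponent H X W → Satisfies Γ H σ W ψ) →
      KConsistent Γ H σ k X ψ)
mainTheorem9 H _ Γ _ σ k X ψ =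
  (λ consistent W ∣W∣≤k (_ , closedW , _) →
     consistent W ∣W∣≤k (closed⇒boundary⊆X H X Γ closedW)) ,
  (λ components W ∣W∣≤k ∂W⊆X →
     closed-satisfies Γ H X σ ψ k components W ∣W∣≤k (boundary⊆X⇒closed H X Γ ∂W⊆X))
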